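{- Let $n\geq 1$, $a=[n,n+1,\ldots,n+5]$, $b=F_nF_{n+1}\cdots F_{n+5}$, and $c=(5,n)$. Then \[ z(b)=\begin{cases} ac, & \text{if } n\equiv 1,2,3,4,5,6\pmod{12}, \text{ or } n\equiv 7,8,59,60\pmod{72};\\ 2ac, & \text{if } n\equiv 9,10\pmod{12}, \text{ or } n\equiv 23,24,43,44\pmod{72};\\ 3ac, & \text{if } n\equiv 11,12,31,32,35,36,55,56\pmod{72};\\ 6ac, & \text{if } n\equiv 0,19,20,47,48,67,68,71\pmod{72}. \end{cases} \]
   Context: $F_n$ is the $n$th Fibonacci number ($F_1=F_2=1$, $F_n=F_{n-1}+F_{n-2}$). For a positive integer $m$, $z(m)$ is the smallest positive integer $k$ with $m\mid F_k$. $(\cdot,\cdot)$ denotes gcd and $[\cdots]$ lcm. -}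

module Defs where

open import Data.Nat using (ℕ; zero; suc; _+_; _*_; _≤_)
open import Data.Nat.Divisibility using (_∣_)
open import Data.Nat.LCM using (lcm)
open import Data.Product using (_×_)

F : ℕ → ℕ
F zero = 0
F (suc zero) = 1
F (suc (suc n)) = F (suc n) + F n

IsZ : ℕ → ℕ → Set
IsZ m k = (1 ≤ k) × (m ∣ F k) × (∀ j → 1 ≤ j → m ∣ F j → k ≤ j)

lcm6 : ℕ → ℕ
lcm6 n = lcm n (lcm (n + 1) (lcm (n + 2) (lcm (n + 3) (lcm (n + 4) (n + 5)))))

prodF6 : ℕ → ℕ
prodF6 n = F n * (F (n + 1) * (F (n + 2) * (F (n + 3) * (F (n + 4) * F (n + 5)))))

-- Everything rests on a lifting
-- lemma: if a prime p divides F x and x ∣ k, then p · F x ∣ F k iff p · x ∣ k.  It comes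
-- from F ((q + 1) x) ≡ (q + 1) · F x · F (x - 1) ^ q modulo F x ², and F (x - 1) is prime to p.
--
-- The gcd of two of F n, …, F (n + 5) divides one of F 1, …, F 5, so the only shared
-- primes are 2 = F 3, 3 = F 4 and 5 = F 5, and p = F r is shared only by a pair x, x + r of
-- multiples of r in the block.  Splitting off the 2-, 3- and 5-parts of every factor, the
-- lifting lemma gives: b ∣ F k iff every n + i divides k and F r · x ∣ k for each member x
-- of such a pair.  For r = 5 this costs exactly the factor (5, n).  For r = 3, 4 it costs
-- the factor F r exactly when some pair member carries a power of F r that no other
-- element of the block reaches; which of the two cases occurs depends only on n mod 72
-- and is decided by computation.
module Submission where

open import Defs
open import Data.Nat
open import Data.Nat.Properties
open import Data.Nat.Divisibility
open import Data.Nat.DivMod using (_%_; _/_; m%n<n; m≡m%n+[m/n]*n; m∣n⇒o%n%m≡o%m)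
open import Data.Nat.GCD using (gcd; gcd[m,n]∣m; gcd-greatest)
open import Data.Nat.LCM using (lcm; lcm-least; lcm-comm; gcd*lcm; m∣lcm[m,n]; n∣lcm[m,n])
open import Data.Nat.Coprimality using (Coprime; coprime?; coprime-divisor; coprime⇒gcd≡1)
import Data.Nat.Coprimality as Coprime
open import Data.Nat.Primality
  using (Prime; prime?; prime[2]; euclidsLemma; prime⇒irreducible; prime⇒nonZero; prime⇒nonTrivial)
open import Data.Nat.Induction using (<-rec)
open import Data.Nat.Tactic.RingSolver using (solve-∀)
open import Data.List using (_∷_; [])
open import Data.List.Membership.Propositional using (_∈_)
open import Data.List.Membership.DecPropositional _≟_ using (_∈?_)
open import Data.Product using (∃; ∃₂; _×_; _,_; proj₁; proj₂)
open import Data.Sum using (_⊎_; inj₁; inj₂; [_,_]′; map₁)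
import Data.Sum as Sum
open import Data.Empty using (⊥-elim)
open import Function using (_∘_; id; _⇔_; mk⇔; Equivalence)
open import Function.Construct.Composition using (_⇔-∘_)
open import Relation.Nullary using (¬_; Dec; yes; no)
open import Relation.Nullary.Decidable using (from-yes; _×-dec_; _⊎-dec_; _→-dec_; ¬?)
open import Relation.Binary.PropositionalEquality
  using (_≡_; _≢_; refl; sym; trans; cong; cong₂; subst; module ≡-Reasoning)

private variable
  d e k m n o p r s x : ℕ
  g h : ℕ → ℕ

prime∤⇒coprime : Prime p → ¬ p ∣ n → Coprime p n
prime∤⇒coprime p-prime p∤n (d∣p , d∣n) with prime⇒irreducible p-prime d∣p
... | inj₁ d≡1 = d≡1
... | inj₂ refl = ⊥-elim (p∤n d∣n)

prime∤1 : Prime p → ¬ p ∣ 1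
prime∤1 p-prime p∣1 = nonTrivial⇒≢1 {{prime⇒nonTrivial p-prime}} (∣1⇒≡1 p∣1)

prime∤* : Prime p → ¬ p ∣ m → ¬ p ∣ n → ¬ p ∣ m * n
prime∤* {m = m} {n} p-prime p∤m p∤n p∣mn with euclidsLemma m n p-prime p∣mn
... | inj₁ p∣m = p∤m p∣m
... | inj₂ p∣n = p∤n p∣n

prime∤^ : Prime p → ¬ p ∣ m → ∀ e → ¬ p ∣ m ^ e
prime∤^ p-prime p∤m zero    = prime∤1 p-prime
prime∤^ p-prime p∤m (suc e) = prime∤* p-prime p∤m (prime∤^ p-prime p∤m e)

prime-3 : Prime 3
prime-3 = from-yes (prime? 3)

prime-5 : Prime 5
prime-5 = from-yes (prime? 5)

coprime-* : Coprime m o → Coprime n o → Coprime (m * n) o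
coprime-* {m} {o} {n} m⊥o n⊥o {d} (d∣mn , d∣o) = n⊥o (coprime-divisor d⊥m d∣mn , d∣o)
  where
  d⊥m : Coprime d m
  d⊥m (e∣d , e∣m) = m⊥o (e∣m , ∣-trans e∣d d∣o)

coprime-^ : Coprime m o → ∀ e → Coprime (m ^ e) o
coprime-^ m⊥o zero    (d∣1 , _) = ∣1⇒≡1 d∣1
coprime-^ m⊥o (suc e) = coprime-* m⊥o (coprime-^ m⊥o e)

coprime⇒*∣ : Coprime m n → m ∣ o → n ∣ o → m * n ∣ o
coprime⇒*∣ {m} {n} m⊥n (divides q refl) n∣qm =
  subst (m * n ∣_) (*-comm m q) (*-monoʳ-∣ m (coprime-divisor (Coprime.sym m⊥n) (subst (n ∣_) (*-comm q m) n∣qm)))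

coprime-∣ : m ∣ o → n ∣ x → Coprime o x → Coprime m n
coprime-∣ m∣o n∣x o⊥x (d∣m , d∣n) = o⊥x (∣-trans d∣m m∣o , ∣-trans d∣n n∣x)

coprime-*-∣ : ∀ {u v a k} → Coprime u v → 0 < a → u * a ∣ k → v * a ∣ k → u * v * a ∣ k
coprime-*-∣ {u} {v} {a} u⊥v 0<a u*a∣k v*a∣k with ∣-trans (n∣m*n u) u*a∣k
... | divides t refl = *-monoˡ-∣ a (coprime⇒*∣ u⊥v (*-cancelʳ-∣ {u} {t} a u*a∣k) (*-cancelʳ-∣ {v} {t} a v*a∣k))
  where instance _ = >-nonZero 0<a

prime-split : Prime p → ∀ x → 0 < x → ∃₂ λ e o → x ≡ p ^ e * o × ¬ p ∣ o
prime-split {p} p-prime = <-rec _ step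
  where
  step : ∀ x → (∀ {y} → y < x → 0 < y → ∃₂ λ e o → y ≡ p ^ e * o × ¬ p ∣ o) →
         0 < x → ∃₂ λ e o → x ≡ p ^ e * o × ¬ p ∣ o
  step x rec 0<x with p ∣? x
  ... | no p∤x = 0 , x , sym (+-identityʳ x) , p∤x
  ... | yes (divides zero refl) = ⊥-elim (<-irrefl refl 0<x)
  ... | yes (divides q@(suc _) refl) with rec (m<m*n q p (nonTrivial⇒n>1 p {{prime⇒nonTrivial p-prime}})) (s≤s z≤n)
  ...   | e , o , q≡ , p∤o = suc e , o , trans (cong (_* p) q≡) (reassoc (p ^ e) o p) , p∤o
    where
    reassoc : ∀ a o p → a * o * p ≡ p * a * o
    reassoc = solve-∀

^-monoʳ-∣ : ∀ p {e f} → e ≤ f → p ^ e ∣ p ^ f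
^-monoʳ-∣ p {e} e≤f with m≤n⇒∃[o]m+o≡n e≤f
... | o , refl = divides (p ^ o) (trans (^-distribˡ-+-* p e o) (*-comm (p ^ e) (p ^ o)))

p^[1+k]∤p^k* : Prime p → ¬ p ∣ o → ∀ k → ¬ p ^ suc k ∣ p ^ k * o
p^[1+k]∤p^k* {p} {o} p-prime p∤o k p^[1+k]∣ =
  p∤o (*-cancelˡ-∣ (p ^ k) {{m^n≢0 p k {{prime⇒nonZero p-prime}}}}
        (subst (_∣ p ^ k * o) (*-comm p (p ^ k)) p^[1+k]∣))

exponent-≤ : Prime p → ¬ p ∣ o → ∀ e k → p ^ e ∣ p ^ k * o → e ≤ k
exponent-≤ {p} {o} p-prime p∤o e k p^e∣ with e ≤? k
... | yes e≤k = e≤k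
... | no  e≰k = ⊥-elim (p^[1+k]∤p^k* p-prime p∤o k (∣-trans (^-monoʳ-∣ p (≰⇒> e≰k)) p^e∣))

^∣-below-square : p ^ e ∣ m → ¬ p * p ∣ m → p ^ e ∣ p
^∣-below-square {p} {zero}          _     _      = 1∣ p
^∣-below-square {p} {suc zero}      _     _      = subst (_∣ p) (sym (*-identityʳ p)) ∣-refl
^∣-below-square {p} {suc (suc e)} p^e∣m p²∤m =
  ⊥-elim (p²∤m (∣-trans (divides (p ^ e) (reassoc p (p ^ e))) p^e∣m))
  where
  reassoc : ∀ p a → p * (p * a) ≡ a * (p * p)
  reassoc = solve-∀

∣-extend-by-prime : Prime p → x ∣ m → p ^ k ∣ m → ¬ p ^ k ∣ x → p * x ∣ m
∣-extend-by-prime {p} {x} {k = k} p-prime (divides t refl) p^k∣tx p^k∤x with p ∣? t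
... | yes (divides s refl) = divides s (reassoc s p x)
  where
  reassoc : ∀ s p x → s * p * x ≡ s * (p * x)
  reassoc = solve-∀
... | no p∤t = ⊥-elim (p^k∤x (coprime-divisor (coprime-^ (prime∤⇒coprime p-prime p∤t) k) p^k∣tx))

lcm-pos : 0 < m → 0 < n → 0 < lcm m n
lcm-pos {m} {n} 0<m 0<n with lcm m n in eq
... | suc _ = s≤s z≤n
... | zero  = ⊥-elim (<-irrefl (sym mn≡0) (*-mono-< 0<m 0<n))
  where
  mn≡0 : m * n ≡ 0
  mn≡0 = trans (sym (gcd*lcm m n)) (trans (cong (gcd m n *_) eq) (*-zeroʳ (gcd m n)))

prime^∣lcm-of-split : Prime p → e ≤ k → ¬ p ∣ m → ¬ p ∣ n →
                      p ^ o ∣ lcm (p ^ e * m) (p ^ k * n) → p ^ o ∣ p ^ k * n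
prime^∣lcm-of-split {p} {e} {k} {m} {n} {o} p-prime e≤k p∤m p∤n p^o∣lcm =
  ∣-trans (coprime-divisor p^o⊥mn (∣-trans p^o∣lcm lcm∣)) (m∣m*n n)
  where
  p^o⊥mn : Coprime (p ^ o) (m * n)
  p^o⊥mn = coprime-^ (prime∤⇒coprime p-prime (prime∤* p-prime p∤m p∤n)) o
  lcm∣ : lcm (p ^ e * m) (p ^ k * n) ∣ m * n * p ^ k
  lcm∣ = subst (lcm (p ^ e * m) (p ^ k * n) ∣_) (*-comm (p ^ k) (m * n))
    (lcm-least (*-pres-∣ (^-monoʳ-∣ p e≤k) (m∣m*n n)) (*-monoʳ-∣ (p ^ k) (n∣m*n m)))

prime^∣lcm : Prime p → 0 < m → 0 < n → p ^ k ∣ lcm m n → p ^ k ∣ m ⊎ p ^ k ∣ n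
prime^∣lcm {p} {m} {n} {k} p-prime 0<m 0<n p^k∣lcm
  with prime-split p-prime m 0<m | prime-split p-prime n 0<n
... | e , m₀ , refl , p∤m₀ | f , n₀ , refl , p∤n₀ with ≤-total e f
...   | inj₁ e≤f = inj₂ (prime^∣lcm-of-split {o = k} p-prime e≤f p∤m₀ p∤n₀ p^k∣lcm)
...   | inj₂ f≤e = inj₁ (prime^∣lcm-of-split {o = k} p-prime f≤e p∤n₀ p∤m₀
                          (subst (p ^ k ∣_) (lcm-comm (p ^ e * m₀) (p ^ f * n₀)) p^k∣lcm))

0<*⇒0<ʳ : ∀ m n → 0 < m * n → 0 < n
0<*⇒0<ʳ m zero    0<m*0 = ⊥-elim (<-irrefl (sym (*-zeroʳ m)) 0<m*0)
0<*⇒0<ʳ m (suc n) _     = s≤s z≤n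

∣suc⇒pos : m ∣ suc n → 0 < m
∣suc⇒pos {zero} 0∣ with () ← 0∣⇒≡0 0∣
∣suc⇒pos {suc m} _ = s≤s z≤n

∏< : ℕ → (ℕ → ℕ) → ℕ
∏< zero    g = 1
∏< (suc k) g = ∏< k g * g k

syntax ∏< k (λ i → t) = ∏[ i < k ] t

∏-cong : (∀ i → i < k → g i ≡ h i) → ∏< k g ≡ ∏< k h
∏-cong {zero}  g≡h = refl
∏-cong {suc k} g≡h = cong₂ _*_ (∏-cong (λ i i<k → g≡h i (m<n⇒m<1+n i<k))) (g≡h k ≤-refl)

∏-* : ∀ k → ∏[ i < k ] (g i * h i) ≡ ∏< k g * ∏< k h
∏-* zero    = refl
∏-* {g} {h} (suc k) = trans (cong (_* (g k * h k)) (∏-* k)) (interchange (∏< k g) (∏< k h) (g k) (h k))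
  where
  interchange : ∀ a b c d → a * b * (c * d) ≡ a * c * (b * d)
  interchange = solve-∀

prime∤∏ : Prime p → (∀ i → i < k → ¬ p ∣ g i) → ¬ p ∣ ∏< k g
prime∤∏ {k = zero}  p-prime p∤g = prime∤1 p-prime
prime∤∏ {k = suc k} p-prime p∤g =
  prime∤* p-prime (prime∤∏ p-prime (λ i i<k → p∤g i (m<n⇒m<1+n i<k))) (p∤g k ≤-refl)

coprime-∏ : (∀ i → i < k → Coprime (g i) m) → Coprime (∏< k g) m
coprime-∏ {zero}  g⊥m (d∣1 , _) = ∣1⇒≡1 d∣1
coprime-∏ {suc k} g⊥m = coprime-* (coprime-∏ (λ i i<k → g⊥m i (m<n⇒m<1+n i<k))) (g⊥m k ≤-refl)

∏-∣-pairwise : (∀ {i j} → i < j → j < k → Coprime (g i) (g j)) →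
               (∀ i → i < k → g i ∣ m) → ∏< k g ∣ m
∏-∣-pairwise {zero}  _ _ = 1∣ _
∏-∣-pairwise {suc k} pairwise g∣m = coprime⇒*∣
  (coprime-∏ (λ i i<k → pairwise i<k ≤-refl))
  (∏-∣-pairwise (λ i<j j<k → pairwise i<j (m<n⇒m<1+n j<k)) (λ i i<k → g∣m i (m<n⇒m<1+n i<k)))
  (g∣m k ≤-refl)

∣∏ : ∀ {i} → i < k → g i ∣ ∏< k g
∣∏ {suc k} {g} {i} i<1+k with m<1+n⇒m<n∨m≡n i<1+k
... | inj₁ i<k  = ∣m⇒∣m*n (g k) (∣∏ i<k)
... | inj₂ refl = n∣m*n (∏< k g)

*∣∏ : ∀ {i j} → i < j → j < k → g i * g j ∣ ∏< k g
*∣∏ {suc k} {g} {i} {j} i<j j<1+k with m<1+n⇒m<n∨m≡n j<1+k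
... | inj₁ j<k  = ∣m⇒∣m*n (g k) (*∣∏ i<j j<k)
... | inj₂ refl = *-monoˡ-∣ (g j) (∣∏ i<j)

∏-trivial : (∀ l → l < k → g l ≡ 1) → ∏< k g ≡ 1
∏-trivial {zero}  _   = refl
∏-trivial {suc k} g≡1 = cong₂ _*_ (∏-trivial (λ l l<k → g≡1 l (m<n⇒m<1+n l<k))) (g≡1 k ≤-refl)

∏-support₁ : ∀ {i} → i < k → (∀ l → l < k → l ≢ i → g l ≡ 1) → ∏< k g ≡ g i
∏-support₁ {suc k} {g} {i} i<1+k g≡1 with m<1+n⇒m<n∨m≡n i<1+k
... | inj₁ i<k  = trans (cong₂ _*_ (∏-support₁ i<k (λ l l<k → g≡1 l (m<n⇒m<1+n l<k)))
                                   (g≡1 k ≤-refl (>⇒≢ i<k)))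
                        (*-identityʳ (g i))
... | inj₂ refl = trans (cong (_* g k) (∏-trivial (λ l l<k → g≡1 l (m<n⇒m<1+n l<k) (<⇒≢ l<k))))
                        (*-identityˡ (g k))

∏-support₂ : ∀ {i j} → i < j → j < k → (∀ l → l < k → l ≢ i → l ≢ j → g l ≡ 1) →
             ∏< k g ≡ g i * g j
∏-support₂ {suc k} {g} {i} {j} i<j j<1+k g≡1 with m<1+n⇒m<n∨m≡n j<1+k
... | inj₁ j<k  = trans (cong₂ _*_ (∏-support₂ i<j j<k (λ l l<k → g≡1 l (m<n⇒m<1+n l<k)))
                                   (g≡1 k ≤-refl (>⇒≢ (<-trans i<j j<k)) (>⇒≢ j<k)))
                        (*-identityʳ (g i * g j))
... | inj₂ refl = cong (_* g k) (∏-support₁ i<j (λ l l<k l≢i → g≡1 l (m<n⇒m<1+n l<k) l≢i (<⇒≢ l<k)))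

∏-split-∣ : ∀ {ν : ℕ → ℕ} → Prime p → (∀ i → i < k → g i ≡ p ^ ν i * h i) →
            (∀ i → i < k → ¬ p ∣ h i) → ∏[ i < k ] (p ^ ν i) ∣ m → ∏< k h ∣ m → ∏< k g ∣ m
∏-split-∣ {p} {k} {g} {h} {m} {ν} p-prime g≡ p∤h p^ν∣m h∣m =
  subst (_∣ m) (sym (trans (∏-cong g≡) (∏-* {g = λ i → p ^ ν i} {h} k)))
    (coprime⇒*∣ (coprime-∏ {k} (λ i _ → coprime-^ p⊥∏h (ν i))) p^ν∣m h∣m)
  where
  p⊥∏h : Coprime p (∏< k h)
  p⊥∏h = prime∤⇒coprime p-prime (prime∤∏ p-prime p∤h)

-- Divisibility of Fibonacci numbers

F-+ : ∀ m n → F (suc (m + n)) ≡ F (suc m) * F (suc n) + F m * F n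
F-+ zero    n = ring (F (suc n)) (F n)
  where
  ring : ∀ x y → x ≡ 1 * x + 0 * y
  ring = solve-∀
F-+ (suc m) n = begin
  F (suc (suc (m + n)))                               ≡⟨ cong (F ∘ suc) (+-suc m n) ⟨
  F (suc (m + suc n))                                 ≡⟨ F-+ m (suc n) ⟩
  F (suc m) * (F (suc n) + F n) + F m * F (suc n)     ≡⟨ ring (F (suc m)) (F m) (F (suc n)) (F n) ⟩
  (F (suc m) + F m) * F (suc n) + F (suc m) * F n     ∎
  where
  open ≡-Reasoning
  ring : ∀ a b c d → a * (c + d) + b * c ≡ (a + b) * c + a * d
  ring = solve-∀

F-pos : ∀ k → 0 < F (suc k)
F-pos zero    = s≤s z≤n
F-pos (suc k) = ≤-trans (F-pos k) (m≤m+n _ _)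

F-mono-≤ : m ≤ n → F m ≤ F n
F-mono-≤ {m} m≤n with m≤n⇒∃[o]m+o≡n m≤n
... | o , refl = go o
  where
  step : ∀ k → F k ≤ F (suc k)
  step zero    = z≤n
  step (suc k) = m≤m+n _ _
  go : ∀ o → F m ≤ F (m + o)
  go zero    = ≤-reflexive (cong F (sym (+-identityʳ m)))
  go (suc o) = ≤-trans (go o) (subst (λ k → F (m + o) ≤ F k) (sym (+-suc m o)) (step (m + o)))

F-coprime : ∀ k → Coprime (F k) (F (suc k))
F-coprime zero    (_ , d∣1) = ∣1⇒≡1 d∣1
F-coprime (suc k) (d∣F[1+k] , d∣F[2+k]) = F-coprime k (∣m+n∣m⇒∣n d∣F[2+k] d∣F[1+k] , d∣F[1+k])

F-∣-multiple : ∀ m q → F m ∣ F (q * m)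
F-∣-multiple m       zero    = F m ∣0
F-∣-multiple zero    (suc q) = subst (λ k → 0 ∣ F k) (sym (*-zeroʳ (suc q))) ∣-refl
F-∣-multiple (suc m) (suc q) = subst (F (suc m) ∣_) (sym (F-+ m (q * suc m)))
  (∣m∣n⇒∣m+n (∣m⇒∣m*n _ ∣-refl) (∣n⇒∣m*n (F m) (F-∣-multiple (suc m) q)))

∣⇒F∣F : m ∣ n → F m ∣ F n
∣⇒F∣F {m} (divides q refl) = F-∣-multiple m q

F-common-divisor : ∀ δ k → d ∣ F k → d ∣ F (δ + k) → d ∣ F δ
F-common-divisor zero    k _ _ = _ ∣0
F-common-divisor {d} (suc δ) k d∣F[k] d∣F[1+δ+k] = coprime-divisor d⊥F[1+k]
  (subst (d ∣_) (*-comm (F (suc δ)) (F (suc k)))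
    (∣m+n∣m⇒∣n (subst (d ∣_) (trans (F-+ δ k) (+-comm _ (F δ * F k))) d∣F[1+δ+k])
               (∣n⇒∣m*n (F δ) d∣F[k])))
  where
  d⊥F[1+k] : Coprime d (F (suc k))
  d⊥F[1+k] (e∣d , e∣F[1+k]) = F-coprime k (∣-trans e∣d d∣F[k] , e∣F[1+k])

F∣F⇒∣ : 3 ≤ m → F m ∣ F n → m ∣ n
F∣F⇒∣ {1} (s≤s ()) _
F∣F⇒∣ {2} (s≤s (s≤s ())) _
F∣F⇒∣ {m@(suc (suc (suc e)))} {n} _ F[m]∣F[n] with n % m in r≡
... | zero  = m%n≡0⇒n∣m n m r≡
... | suc r = ⊥-elim (<⇒≱ F[1+r]<F[m] (∣⇒≤ {{>-nonZero (F-pos r)}} F[m]∣F[1+r]))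
  where
  F[m]∣F[1+r] : F m ∣ F (suc r)
  F[m]∣F[1+r] = F-common-divisor (suc r) (n / m * m) (F-∣-multiple m (n / m))
    (subst (λ k → F m ∣ F k) (trans (m≡m%n+[m/n]*n n m) (cong (_+ n / m * m) r≡)) F[m]∣F[n])
  F[1+r]<F[m] : F (suc r) < F m
  F[1+r]<F[m] = ≤-trans (s≤s (F-mono-≤ (≤-pred (subst (_< m) r≡ (m%n<n n m)))))
    (subst (_≤ F m) (+-comm (F (suc (suc e))) 1) (+-monoʳ-≤ (F (suc (suc e))) (F-pos e)))

-- Lifting the exponent of a prime dividing F x

-- The second equation is the invariant that carries the induction.
F-multiple : ∀ m q → ∃₂ λ S T →
  F (suc q * suc m) ≡ F (suc m) * (suc q * F m ^ q + F (suc m) * S) ×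
  F (suc (suc q * suc m)) ≡ F m ^ suc q + F (suc m) * T
F-multiple m zero = 0 , 1 , A , B
  where
  open ≡-Reasoning
  A : F (suc (m + 0)) ≡ F (suc m) * (1 * 1 + F (suc m) * 0)
  A = begin
    F (suc (m + 0))  ≡⟨ cong (F ∘ suc) (+-identityʳ m) ⟩
    F (suc m)        ≡⟨ ring (F (suc m)) ⟩
    F (suc m) * (1 * 1 + F (suc m) * 0) ∎
    where
    ring : ∀ x → x ≡ x * (1 * 1 + x * 0)
    ring = solve-∀
  B : F (suc (suc (m + 0))) ≡ F m * 1 + F (suc m) * 1
  B = begin
    F (suc (suc (m + 0)))  ≡⟨ cong (F ∘ suc ∘ suc) (+-identityʳ m) ⟩
    F (suc m) + F m        ≡⟨ ring (F (suc m)) (F m) ⟩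
    F m * 1 + F (suc m) * 1 ∎
    where
    ring : ∀ x w → x + w ≡ w * 1 + x * 1
    ring = solve-∀
F-multiple m (suc q) with F-multiple m q
... | S , T , A , B = T + w * S , w * W + (X + w) * T + suc q * X * W + X * X * S , A′ , B′
  where
  open ≡-Reasoning
  X w W Q : ℕ
  X = F (suc m)
  w = F m
  W = F m ^ q
  Q = suc q * suc m
  A′ : F (suc (m + Q)) ≡ X * (suc (suc q) * (w * W) + X * (T + w * S))
  A′ = begin
    F (suc (m + Q))                                  ≡⟨ F-+ m Q ⟩
    X * F (suc Q) + w * F Q                          ≡⟨ cong₂ (λ a b → X * a + w * b) B A ⟩
    X * (w * W + X * T) + w * (X * (suc q * W + X * S)) ≡⟨ ring q X w W S T ⟩
    X * (suc (suc q) * (w * W) + X * (T + w * S))     ∎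
    where
    ring : ∀ q X w W S T → X * (w * W + X * T) + w * (X * ((1 + q) * W + X * S))
                         ≡ X * ((2 + q) * (w * W) + X * (T + w * S))
    ring = solve-∀
  B′ : F (suc (suc (m + Q))) ≡ w * (w * W) + X * (w * W + (X + w) * T + suc q * X * W + X * X * S)
  B′ = begin
    F (suc (suc m + Q))                               ≡⟨ F-+ (suc m) Q ⟩
    (X + w) * F (suc Q) + X * F Q                     ≡⟨ cong₂ (λ a b → (X + w) * a + X * b) B A ⟩
    (X + w) * (w * W + X * T) + X * (X * (suc q * W + X * S)) ≡⟨ ring q X w W S T ⟩
    w * (w * W) + X * (w * W + (X + w) * T + suc q * X * W + X * X * S) ∎
    where
    ring : ∀ q X w W S T → (X + w) * (w * W + X * T) + X * (X * ((1 + q) * W + X * S))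
                         ≡ w * (w * W) + X * (w * W + (X + w) * T + (1 + q) * X * W + X * X * S)
    ring = solve-∀

p*F∣F⇔p*∣ : Prime p → p ∣ F x → x ∣ k → (p * F x ∣ F k ⇔ p * x ∣ k)
p*F∣F⇔p*∣ {p} {zero} _ _ (divides q refl) rewrite *-zeroʳ q | *-zeroʳ p = mk⇔ id id
p*F∣F⇔p*∣ {p} {suc m} _ _ (divides zero refl) = mk⇔ (λ _ → _ ∣0) (λ _ → _ ∣0)
p*F∣F⇔p*∣ {p} {suc m} p-prime p∣X (divides (suc q) refl) with F-multiple m q
... | S , _ , F[qx]≡ , _ = mk⇔ to from
  where
  X G : ℕ
  X = F (suc m)
  G = suc q * F m ^ q + X * S
  instance _ = >-nonZero (F-pos m)
  p∤F[m]^q : ¬ p ∣ F m ^ q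
  p∤F[m]^q = prime∤^ p-prime (λ p∣F[m] → prime∤1 p-prime (subst (p ∣_) (F-coprime m (p∣F[m] , p∣X)) ∣-refl)) q
  p∣X*S : p ∣ X * S
  p∣X*S = ∣m⇒∣m*n S p∣X
  p*X∣F⇔p∣G : p * X ∣ F (suc q * suc m) ⇔ p ∣ G
  p*X∣F⇔p∣G = mk⇔
    (λ h → *-cancelˡ-∣ X (subst (X * p ∣_) F[qx]≡ (subst (_∣ F (suc q * suc m)) (*-comm p X) h)))
    (λ h → subst (p * X ∣_) (sym F[qx]≡) (subst (_∣ X * G) (*-comm X p) (*-monoʳ-∣ X h)))
  to : p * X ∣ F (suc q * suc m) → p * suc m ∣ suc q * suc m
  to h with euclidsLemma (suc q) (F m ^ q) p-prime
              (∣m+n∣m⇒∣n (subst (p ∣_) (+-comm (suc q * F m ^ q) (X * S)) (Equivalence.to p*X∣F⇔p∣G h)) p∣X*S)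
  ... | inj₁ p∣q = *-monoˡ-∣ (suc m) p∣q
  ... | inj₂ p∣W = ⊥-elim (p∤F[m]^q p∣W)
  from : p * suc m ∣ suc q * suc m → p * X ∣ F (suc q * suc m)
  from h = Equivalence.from p*X∣F⇔p∣G
    (∣m∣n⇒∣m+n (∣m⇒∣m*n (F m ^ q) (*-cancelʳ-∣ {p} {suc q} (suc m) h)) p∣X*S)

module Rank {r} (3≤r : 3 ≤ r) (F[r]-prime : Prime (F r)) where

  private instance
    r≢0 : NonZero r
    r≢0 = >-nonZero (≤-trans (s≤s z≤n) 3≤r)

  lift : ∀ x → r ∣ x → F r * x ∣ k → F r * F x ∣ F k
  lift x r∣x Fr*x∣k =
    Equivalence.from (p*F∣F⇔p*∣ F[r]-prime (∣⇒F∣F r∣x) (∣-trans (n∣m*n (F r)) Fr*x∣k)) Fr*x∣k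

  descend : ∀ x → r ∣ x → x ∣ k → F r * F x ∣ F k → F r * x ∣ k
  descend x r∣x x∣k = Equivalence.to (p*F∣F⇔p*∣ F[r]-prime (∣⇒F∣F r∣x) x∣k)

  F[r]²∣F⇒ : ∀ k → F r * F r ∣ F k → F r * r ∣ k
  F[r]²∣F⇒ k Fr²∣F[k] = descend r ∣-refl (F∣F⇒∣ 3≤r (∣-trans (n∣m*n (F r)) Fr²∣F[k])) Fr²∣F[k]

  F[r]²∤F-pair : ∀ x → F r * F r ∣ F x → ¬ F r * F r ∣ F (x + r)
  F[r]²∤F-pair x Fr²∣F[x] Fr²∣F[x+r] = prime∤1 F[r]-prime (*-cancelʳ-∣ r
    (subst (F r * r ∣_) (sym (*-identityˡ r))
      (∣m+n∣m⇒∣n (F[r]²∣F⇒ (x + r) Fr²∣F[x+r]) (F[r]²∣F⇒ x Fr²∣F[x]))))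

  F[r]^-pair-∣ : ∀ x → r ∣ x → F r ^ e ∣ F x → F r ^ o ∣ F (x + r) →
                 F r * x ∣ k → F r * (x + r) ∣ k → F r ^ e * F r ^ o ∣ F k
  F[r]^-pair-∣ {e} {o} {k} x r∣x Fr^e∣ Fr^o∣ Fr*x∣k Fr*[x+r]∣k with F r * F r ∣? F (x + r)
  ... | no  Fr²∤F[x+r] =
    ∣-trans (*-pres-∣ Fr^e∣ (^∣-below-square {F r} {o} Fr^o∣ Fr²∤F[x+r]))
            (subst (_∣ F k) (*-comm (F r) (F x)) (lift x r∣x Fr*x∣k))
  ... | yes Fr²∣F[x+r] =
    ∣-trans (*-pres-∣ (^∣-below-square {F r} {e} Fr^e∣ (λ Fr²∣F[x] → F[r]²∤F-pair x Fr²∣F[x] Fr²∣F[x+r])) Fr^o∣)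
            (lift (x + r) (∣m∣n⇒∣m+n r∣x ∣-refl) Fr*[x+r]∣k)

-- The product of six consecutive Fibonacci numbers

multiple-in-range : ∀ r n .{{_ : NonZero r}} → ∃ λ i → i < r × r ∣ n + i
multiple-in-range r n with n % r in n%r≡
... | zero  = 0 , >-nonZero⁻¹ r , subst (r ∣_) (sym (+-identityʳ n)) (m%n≡0⇒n∣m n r n%r≡)
... | suc ρ = r ∸ suc ρ , ∸-monoʳ-< (s≤s z≤n) ρ<r , divides (suc (n / r)) n+[r∸ρ]≡
  where
  open ≡-Reasoning
  ρ<r : suc ρ ≤ r
  ρ<r = <⇒≤ (subst (_< r) n%r≡ (m%n<n n r))
  n≡ : n ≡ suc ρ + n / r * r
  n≡ = trans (m≡m%n+[m/n]*n n r) (cong (_+ n / r * r) n%r≡)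
  n+[r∸ρ]≡ : n + (r ∸ suc ρ) ≡ suc (n / r) * r
  n+[r∸ρ]≡ = begin
    n + (r ∸ suc ρ)                       ≡⟨ cong (_+ (r ∸ suc ρ)) n≡ ⟩
    suc ρ + n / r * r + (r ∸ suc ρ)       ≡⟨ +-assoc (suc ρ) (n / r * r) (r ∸ suc ρ) ⟩
    suc ρ + (n / r * r + (r ∸ suc ρ))     ≡⟨ cong (suc ρ +_) (+-comm (n / r * r) (r ∸ suc ρ)) ⟩
    suc ρ + ((r ∸ suc ρ) + n / r * r)     ≡⟨ +-assoc (suc ρ) (r ∸ suc ρ) (n / r * r) ⟨
    suc ρ + (r ∸ suc ρ) + n / r * r       ≡⟨ cong (_+ n / r * r) (m+[n∸m]≡n ρ<r) ⟩
    r + n / r * r                         ∎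

∣-below-double : r ∣ d → d < 2 * r → d ≡ 0 ⊎ d ≡ r
∣-below-double (divides zero refl)                _ = inj₁ refl
∣-below-double {r} (divides (suc zero) refl)      _ = inj₂ (+-identityʳ r)
∣-below-double {r} (divides (suc (suc q)) refl) d<2r = ⊥-elim (<⇒≱ d<2r (+-monoʳ-≤ r (+-monoʳ-≤ r z≤n)))

aligned-positions : ∀ n {i l} → r ∣ n + i → r ∣ n + l → i < r → l < 2 * r → l ≡ i ⊎ l ≡ i + r
aligned-positions {r} n {i} {l} r∣n+i r∣n+l i<r l<2r with ≤-total i l
... | inj₁ i≤l with m≤n⇒∃[o]m+o≡n i≤l
...   | d , refl with ∣-below-double (∣m+n∣m⇒∣n (subst (r ∣_) (sym (+-assoc n i d)) r∣n+l) r∣n+i)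
                                     (≤-trans (s≤s (m≤n+m d i)) l<2r)
...     | inj₁ refl = inj₁ (+-identityʳ i)
...     | inj₂ refl = inj₂ refl
aligned-positions {r} n {i} {l} r∣n+i r∣n+l i<r l<2r | inj₂ l≤i with m≤n⇒∃[o]m+o≡n l≤i
...   | d , refl with ∣-below-double (∣m+n∣m⇒∣n (subst (r ∣_) (sym (+-assoc n l d)) r∣n+i) r∣n+l)
                                     (≤-trans (s≤s (m≤n+m d l)) (≤-trans i<r (m≤m+n r (r + 0))))
...     | inj₁ refl = inj₁ (sym (+-identityʳ l))
...     | inj₂ refl = ⊥-elim (<⇒≱ i<r (m≤n+m r l))

PairCondition : ℕ → ℕ → ℕ → Set
PairCondition r n k = ∀ i → i + r < 6 → r ∣ n + i → F r * (n + i) ∣ k × F r * (n + (i + r)) ∣ k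

∏F^-∣ : 3 ≤ r → Prime (F r) → (ν : ℕ → ℕ) → (∀ i → i < 6 → F r ^ ν i ∣ F (n + i)) →
        (∀ i → i < 6 → n + i ∣ k) → PairCondition r n k → ∏[ i < 6 ] (F r ^ ν i) ∣ F k
∏F^-∣ {r} {n} {k} 3≤r Fr-prime ν Fr^ν∣ n+i∣k pairs = go (multiple-in-range r n)
  where
  instance
    r≢0 : NonZero r
    r≢0 = >-nonZero (≤-trans (s≤s z≤n) 3≤r)
  open Rank 3≤r Fr-prime

  off : ∀ {i₀} → i₀ < r → r ∣ n + i₀ → ∀ l → l < 6 → ¬ (l ≡ i₀ ⊎ l ≡ i₀ + r) → F r ^ ν l ≡ 1
  off {i₀} i₀<r r∣n+i₀ l l<6 unaligned with ν l in ν≡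
  ... | zero  = refl
  ... | suc e = ⊥-elim (unaligned (aligned-positions n r∣n+i₀ r∣n+l i₀<r (≤-trans l<6 (*-monoʳ-≤ 2 3≤r))))
    where
    r∣n+l : r ∣ n + l
    r∣n+l = F∣F⇒∣ 3≤r (∣-trans (m∣m*n (F r ^ e)) (subst (λ j → F r ^ j ∣ F (n + l)) ν≡ (Fr^ν∣ l l<6)))

  go : (∃ λ i → i < r × r ∣ n + i) → ∏[ i < 6 ] (F r ^ ν i) ∣ F k
  go (i₀ , i₀<r , r∣n+i₀) with i₀ + r <? 6 | i₀ <? 6
  ... | yes pair | _ =
    subst (_∣ F k) (sym (∏-support₂ (m<m+n i₀ (≤-trans (s≤s z≤n) 3≤r)) pair
                          (λ l l<6 l≢i₀ l≢i₀+r → off i₀<r r∣n+i₀ l l<6 [ l≢i₀ , l≢i₀+r ]′)))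
      (F[r]^-pair-∣ {ν i₀} {ν (i₀ + r)} (n + i₀) r∣n+i₀ (Fr^ν∣ i₀ (≤-<-trans (m≤m+n i₀ r) pair))
         (subst (λ x → F r ^ ν (i₀ + r) ∣ F x) (sym (+-assoc n i₀ r)) (Fr^ν∣ (i₀ + r) pair))
         (proj₁ (pairs i₀ pair r∣n+i₀))
         (subst (λ x → F r * x ∣ k) (sym (+-assoc n i₀ r)) (proj₂ (pairs i₀ pair r∣n+i₀))))
  ... | no no-pair | yes i₀<6 =
    subst (_∣ F k) (sym (∏-support₁ i₀<6
                          (λ l l<6 l≢i₀ → off i₀<r r∣n+i₀ l l<6 [ l≢i₀ , (λ { refl → no-pair l<6 }) ]′)))
      (∣-trans (Fr^ν∣ i₀ i₀<6) (∣⇒F∣F (n+i∣k i₀ i₀<6)))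
  ... | no _ | no i₀≮6 =
    subst (_∣ F k) (sym (∏-trivial (λ l l<6 → off i₀<r r∣n+i₀ l l<6
                          [ (λ { refl → i₀≮6 l<6 }) , (λ { refl → i₀≮6 (≤-trans (s≤s (m≤m+n i₀ r)) l<6) }) ]′)))
      (1∣ F k)

-- x = 2 ^ ν₂ · 3 ^ ν₃ · 5 ^ ν₅ · u with u prime to 30.  The non-divisibility fields are stated
-- for the successive cofactors, so that splitting off 2, then 3, then 5 is definitional.
record Split235 (x : ℕ) : Set where
  field
    ν₂ ν₃ ν₅ u : ℕ
    split : x ≡ 2 ^ ν₂ * (3 ^ ν₃ * (5 ^ ν₅ * u))
    2∤    : ¬ 2 ∣ 3 ^ ν₃ * (5 ^ ν₅ * u)
    3∤    : ¬ 3 ∣ 5 ^ ν₅ * u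
    5∤u   : ¬ 5 ∣ u

  2^ν₂∣ : 2 ^ ν₂ ∣ x
  2^ν₂∣ = subst (2 ^ ν₂ ∣_) (sym split) (m∣m*n _)

  3^ν₃∣ : 3 ^ ν₃ ∣ x
  3^ν₃∣ = subst (3 ^ ν₃ ∣_) (sym split) (∣n⇒∣m*n (2 ^ ν₂) (m∣m*n _))

  5^ν₅∣ : 5 ^ ν₅ ∣ x
  5^ν₅∣ = subst (5 ^ ν₅ ∣_) (sym split) (∣n⇒∣m*n (2 ^ ν₂) (∣n⇒∣m*n (3 ^ ν₃) (m∣m*n u)))

  u∣ : u ∣ x
  u∣ = subst (u ∣_) (sym split) (∣n⇒∣m*n (2 ^ ν₂) (∣n⇒∣m*n (3 ^ ν₃) (∣n⇒∣m*n (5 ^ ν₅) ∣-refl)))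

  30⊥u : Coprime 30 u
  30⊥u = coprime-* (coprime-* (prime∤⇒coprime prime[2] 2∤u) (prime∤⇒coprime prime-3 3∤u))
                   (prime∤⇒coprime prime-5 5∤u)
    where
    2∤u : ¬ 2 ∣ u
    2∤u 2∣u = 2∤ (∣n⇒∣m*n (3 ^ ν₃) (∣n⇒∣m*n (5 ^ ν₅) 2∣u))
    3∤u : ¬ 3 ∣ u
    3∤u 3∣u = 3∤ (∣n⇒∣m*n (5 ^ ν₅) 3∣u)

split235 : ∀ x → 0 < x → Split235 x
split235 x 0<x with prime-split prime[2] x 0<x
... | ν₂ , y , refl , 2∤y with prime-split prime-3 y (0<*⇒0<ʳ (2 ^ ν₂) y 0<x)
...   | ν₃ , z , refl , 3∤z with prime-split prime-5 z (0<*⇒0<ʳ (3 ^ ν₃) z (0<*⇒0<ʳ (2 ^ ν₂) y 0<x))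
...     | ν₅ , u , refl , 5∤u = record
  { ν₂ = ν₂ ; ν₃ = ν₃ ; ν₅ = ν₅ ; u = u ; split = refl ; 2∤ = 2∤y ; 3∤ = 3∤z ; 5∤u = 5∤u }

record Admissible (n k : ℕ) : Set where
  field
    block  : ∀ i → i < 6 → n + i ∣ k
    pairs₂ : PairCondition 3 n k
    pairs₃ : PairCondition 4 n k
    pairs₅ : PairCondition 5 n k

F-small∣30 : ∀ δ → 0 < δ → δ < 6 → F δ ∣ 30
F-small∣30 1 _ _ = 1∣ 30
F-small∣30 2 _ _ = 1∣ 30
F-small∣30 3 _ _ = divides 15 refl
F-small∣30 4 _ _ = divides 10 refl
F-small∣30 5 _ _ = divides 6 refl
F-small∣30 (suc (suc (suc (suc (suc (suc _)))))) _ (s≤s (s≤s (s≤s (s≤s (s≤s (s≤s ()))))))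

admissible⇒∣F : 1 ≤ n → Admissible n k → ∏[ i < 6 ] F (n + i) ∣ F k
admissible⇒∣F {suc n} {k} _ adm =
  ∏-split-∣ {k = 6} {h = λ i → 3 ^ ν₃ (D i) * (5 ^ ν₅ (D i) * u (D i))} {ν = ν₂ ∘ D}
    prime[2] (λ i _ → split (D i)) (λ i _ → 2∤ (D i)) 2-part
    (∏-split-∣ {k = 6} {h = λ i → 5 ^ ν₅ (D i) * u (D i)} {ν = ν₃ ∘ D}
      prime-3 (λ i _ → refl) (λ i _ → 3∤ (D i)) 3-part
      (∏-split-∣ {k = 6} {h = u ∘ D} {ν = ν₅ ∘ D}
        prime-5 (λ i _ → refl) (λ i _ → 5∤u (D i)) 5-part
        (∏-∣-pairwise {6} {u ∘ D} u-coprime (λ i i<6 → ∣-trans (u∣ (D i)) (∣⇒F∣F (block i i<6))))))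
  where
  open Admissible adm
  open Split235
  D : ∀ i → Split235 (F (suc n + i))
  D i = split235 _ (F-pos (n + i))
  2-part : ∏[ i < 6 ] (2 ^ ν₂ (D i)) ∣ F k
  2-part = ∏F^-∣ (m≤m+n 3 0) prime[2] (ν₂ ∘ D) (λ i _ → 2^ν₂∣ (D i)) block pairs₂
  3-part : ∏[ i < 6 ] (3 ^ ν₃ (D i)) ∣ F k
  3-part = ∏F^-∣ (m≤m+n 3 1) prime-3 (ν₃ ∘ D) (λ i _ → 3^ν₃∣ (D i)) block pairs₃
  5-part : ∏[ i < 6 ] (5 ^ ν₅ (D i)) ∣ F k
  5-part = ∏F^-∣ (m≤m+n 3 2) prime-5 (ν₅ ∘ D) (λ i _ → 5^ν₅∣ (D i)) block pairs₅
  u-coprime : ∀ {i j} → i < j → j < 6 → Coprime (u (D i)) (u (D j))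
  u-coprime {i} {j} i<j j<6 {d} (d∣uᵢ , d∣uⱼ) =
    30⊥u (D i) (∣-trans d∣F[j∸i] (F-small∣30 (j ∸ i) (m<n⇒0<n∸m i<j) (≤-<-trans (m∸n≤m j i) j<6)) ,
                d∣uᵢ)
    where
    j∸i+[n+i]≡n+j : j ∸ i + (suc n + i) ≡ suc n + j
    j∸i+[n+i]≡n+j = begin
      j ∸ i + (suc n + i) ≡⟨ +-comm (j ∸ i) (suc n + i) ⟩
      suc n + i + (j ∸ i) ≡⟨ +-assoc (suc n) i (j ∸ i) ⟩
      suc n + (i + (j ∸ i)) ≡⟨ cong (suc n +_) (m+[n∸m]≡n (<⇒≤ i<j)) ⟩
      suc n + j ∎
      where open ≡-Reasoning
    d∣F[j∸i] : d ∣ F (j ∸ i)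
    d∣F[j∸i] = F-common-divisor (j ∸ i) (suc n + i) (∣-trans d∣uᵢ (u∣ (D i)))
      (subst (λ x → d ∣ F x) (sym j∸i+[n+i]≡n+j) (∣-trans d∣uⱼ (u∣ (D j))))

∣F⇒block : 1 ≤ n → ∏[ i < 6 ] F (n + i) ∣ F k → ∀ i → i < 6 → n + i ∣ k
∣F⇒block {n} {k} 1≤n ∏F∣F[k] i i<6 = from-F∣ (n + i) refl
  where
  F∣ : ∀ i → i < 6 → F (n + i) ∣ F k
  F∣ i i<6 = ∣-trans (∣∏ {g = λ i → F (n + i)} i<6) ∏F∣F[k]
  1+i≤n+i : 1 + i ≤ n + i
  1+i≤n+i = +-monoˡ-≤ i 1≤n
  -- F 2 = F 1 carries no information, so the case n + i = 2 is read off from F 4.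
  from-F∣ : ∀ x → n + i ≡ x → x ∣ k
  from-F∣ 0 n+i≡0 = ⊥-elim (<-irrefl (sym n+i≡0) (≤-trans (s≤s z≤n) 1+i≤n+i))
  from-F∣ 1 _     = 1∣ k
  from-F∣ 2 n+i≡2 = ∣-trans (divides 2 refl) (F∣F⇒∣ {4} (s≤s (s≤s (s≤s z≤n)))
    (subst (λ x → F x ∣ F k) (trans (sym (+-assoc n i 2)) (cong (_+ 2) n+i≡2)) (F∣ (i + 2) i+2<6)))
    where
    i+2<6 : i + 2 < 6
    i+2<6 = +-monoˡ-< 2 {i} {4} (≤-trans (subst (1 + i ≤_) n+i≡2 1+i≤n+i) (m≤m+n 2 2))
  from-F∣ x@(suc (suc (suc _))) n+i≡x =
    F∣F⇒∣ (s≤s (s≤s (s≤s z≤n))) (subst (λ x → F x ∣ F k) n+i≡x (F∣ i i<6))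

∣F⇒PairCondition : 3 ≤ r → Prime (F r) → (∀ i → i < 6 → n + i ∣ k) →
                   ∏[ i < 6 ] F (n + i) ∣ F k → PairCondition r n k
∣F⇒PairCondition {r} {n} {k} 3≤r Fr-prime block ∏F∣F[k] i i+r<6 r∣x =
  member r∣x (block i (≤-<-trans (m≤m+n i r) i+r<6)) r∣y pair∣ ,
  member r∣y (block (i + r) i+r<6) r∣x (subst (_∣ F k) (*-comm (F (n + i)) (F (n + (i + r)))) pair∣)
  where
  open Rank 3≤r Fr-prime
  r∣y : r ∣ n + (i + r)
  r∣y = subst (r ∣_) (+-assoc n i r) (∣m∣n⇒∣m+n r∣x ∣-refl)
  pair∣ : F (n + i) * F (n + (i + r)) ∣ F k
  pair∣ = ∣-trans (*∣∏ {g = λ i → F (n + i)} (m<m+n i (≤-trans (s≤s z≤n) 3≤r)) i+r<6) ∏F∣F[k]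
  member : ∀ {a b} → r ∣ a → a ∣ k → r ∣ b → F a * F b ∣ F k → F r * a ∣ k
  member {a} {b} r∣a a∣k r∣b Fa*Fb∣ =
    descend a r∣a a∣k
      (∣-trans (subst (_∣ F a * F b) (*-comm (F a) (F r)) (*-monoʳ-∣ (F a) (∣⇒F∣F r∣b))) Fa*Fb∣)

∣F⇔admissible : 1 ≤ n → (∏[ i < 6 ] F (n + i) ∣ F k ⇔ Admissible n k)
∣F⇔admissible {n} {k} 1≤n = mk⇔ to (admissible⇒∣F 1≤n)
  where
  to : ∏[ i < 6 ] F (n + i) ∣ F k → Admissible n k
  to ∏F∣ = record
    { block  = block
    ; pairs₂ = ∣F⇒PairCondition (m≤m+n 3 0) prime[2] block ∏F∣
    ; pairs₃ = ∣F⇒PairCondition (m≤m+n 3 1) prime-3 block ∏F∣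
    ; pairs₅ = ∣F⇒PairCondition (m≤m+n 3 2) prime-5 block ∏F∣
    }
    where
    block : ∀ i → i < 6 → n + i ∣ k
    block = ∣F⇒block 1≤n ∏F∣

-- Comparison with the lcm of the block

n+i∣lcm6 : ∀ n i → i < 6 → n + i ∣ lcm6 n
n+i∣lcm6 n 0 _ = subst (_∣ lcm6 n) (sym (+-identityʳ n)) (m∣lcm[m,n] n _)
n+i∣lcm6 n 1 _ = ∣-trans (m∣lcm[m,n] (n + 1) _) (n∣lcm[m,n] n _)
n+i∣lcm6 n 2 _ = ∣-trans (m∣lcm[m,n] (n + 2) _) (∣-trans (n∣lcm[m,n] (n + 1) _) (n∣lcm[m,n] n _))
n+i∣lcm6 n 3 _ = ∣-trans (m∣lcm[m,n] (n + 3) _) (∣-trans (n∣lcm[m,n] (n + 2) _)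
                   (∣-trans (n∣lcm[m,n] (n + 1) _) (n∣lcm[m,n] n _)))
n+i∣lcm6 n 4 _ = ∣-trans (m∣lcm[m,n] (n + 4) _) (∣-trans (n∣lcm[m,n] (n + 3) _) (∣-trans (n∣lcm[m,n] (n + 2) _)
                   (∣-trans (n∣lcm[m,n] (n + 1) _) (n∣lcm[m,n] n _))))
n+i∣lcm6 n 5 _ = ∣-trans (n∣lcm[m,n] (n + 4) _) (∣-trans (n∣lcm[m,n] (n + 3) _) (∣-trans (n∣lcm[m,n] (n + 2) _)
                   (∣-trans (n∣lcm[m,n] (n + 1) _) (n∣lcm[m,n] n _))))
n+i∣lcm6 n (suc (suc (suc (suc (suc (suc _)))))) (s≤s (s≤s (s≤s (s≤s (s≤s (s≤s ()))))))

lcm6-∣⇔ : lcm6 n ∣ m ⇔ (∀ i → i < 6 → n + i ∣ m)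
lcm6-∣⇔ {n} = mk⇔ (λ lcm6∣m i i<6 → ∣-trans (n+i∣lcm6 n i i<6) lcm6∣m)
  (λ n+i∣m → lcm-least (subst (_∣ _) (+-identityʳ n) (n+i∣m 0 (m≤m+n 1 5)))
    (lcm-least (n+i∣m 1 (m≤m+n 2 4)) (lcm-least (n+i∣m 2 (m≤m+n 3 3))
      (lcm-least (n+i∣m 3 (m≤m+n 4 2)) (lcm-least (n+i∣m 4 (m≤m+n 5 1)) (n+i∣m 5 ≤-refl))))))

lcm6-pos : 1 ≤ n → 0 < lcm6 n
lcm6-pos {n} 1≤n = lcm-pos 1≤n (lcm-pos (pos 1) (lcm-pos (pos 2) (lcm-pos (pos 3) (lcm-pos (pos 4) (pos 5)))))
  where
  pos : ∀ i → 0 < n + i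
  pos i = ≤-trans 1≤n (m≤m+n n i)

prime^∤lcm6 : Prime p → 1 ≤ n → (∀ i → i < 6 → ¬ p ^ k ∣ n + i) → ¬ p ^ k ∣ lcm6 n
prime^∤lcm6 {p} {n} {k} p-prime 1≤n p^k∤ =
  ∤lcm 1≤n (lcm-pos (pos 1) (lcm-pos (pos 2) (lcm-pos (pos 3) (lcm-pos (pos 4) (pos 5)))))
    (subst (λ x → ¬ p ^ k ∣ x) (+-identityʳ n) (p^k∤ 0 (m≤m+n 1 5)))
  (∤lcm (pos 1) (lcm-pos (pos 2) (lcm-pos (pos 3) (lcm-pos (pos 4) (pos 5)))) (p^k∤ 1 (m≤m+n 2 4))
  (∤lcm (pos 2) (lcm-pos (pos 3) (lcm-pos (pos 4) (pos 5))) (p^k∤ 2 (m≤m+n 3 3))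
  (∤lcm (pos 3) (lcm-pos (pos 4) (pos 5)) (p^k∤ 3 (m≤m+n 4 2))
  (∤lcm (pos 4) (pos 5) (p^k∤ 4 (m≤m+n 5 1)) (p^k∤ 5 ≤-refl)))))
  where
  pos : ∀ i → 0 < n + i
  pos i = ≤-trans 1≤n (m≤m+n n i)
  ∤lcm : ∀ {a b} → 0 < a → 0 < b → ¬ p ^ k ∣ a → ¬ p ^ k ∣ b → ¬ p ^ k ∣ lcm a b
  ∤lcm 0<a 0<b p^k∤a p^k∤b p^k∣lcm = [ p^k∤a , p^k∤b ]′ (prime^∣lcm {k = k} p-prime 0<a 0<b p^k∣lcm)

Multiplier : ℕ → ℕ → ℕ → Set
Multiplier r n c = ∀ {k} → lcm6 n ∣ k → (PairCondition r n k ⇔ c * lcm6 n ∣ k)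

multiplier-1 : PairCondition r n (lcm6 n) → Multiplier r n 1
multiplier-1 {n = n} pairs lcm6∣k = mk⇔ (λ _ → subst (_∣ _) (sym (*-identityˡ (lcm6 n))) lcm6∣k)
  (λ _ i i+r<6 r∣n+i → let p₁ , p₂ = pairs i i+r<6 r∣n+i in ∣-trans p₁ lcm6∣k , ∣-trans p₂ lcm6∣k)

PairMember : ℕ → ℕ → ℕ → Set
PairMember r n s = ∃ λ i → i + r < 6 × r ∣ n + i × (s ≡ i ⊎ s ≡ i + r)

member-∣ : PairMember r n s → PairCondition r n k → F r * (n + s) ∣ k
member-∣ (i , i+r<6 , r∣n+i , inj₁ refl) pairs = proj₁ (pairs i i+r<6 r∣n+i)
member-∣ (i , i+r<6 , r∣n+i , inj₂ refl) pairs = proj₂ (pairs i i+r<6 r∣n+i)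

multiplier-F[r] : Prime (F r) → 1 ≤ n → PairMember r n s → F r ^ e ∣ n + s →
                  (∀ l → l < 6 → l ≢ s → ¬ F r ^ suc e ∣ n + l) → Multiplier r n (F r)
multiplier-F[r] {r} {n} {s} {e} Fr-prime 1≤n member Fr^e∣ maximal {k} lcm6∣k = mk⇔ to from
  where
  to : PairCondition r n k → F r * lcm6 n ∣ k
  to pairs with prime-split Fr-prime (n + s) (≤-trans 1≤n (m≤m+n n s))
  ... | E , o , n+s≡ , Fr∤o =
    ∣-extend-by-prime {k = suc E} Fr-prime lcm6∣k Fr^[1+E]∣k (prime^∤lcm6 {k = suc E} Fr-prime 1≤n ∤)
    where
    Fr^[1+E]∣k : F r ^ suc E ∣ k
    Fr^[1+E]∣k = ∣-trans (*-monoʳ-∣ (F r) (divides o (trans n+s≡ (*-comm (F r ^ E) o)))) (member-∣ member pairs)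
    ∤ : ∀ l → l < 6 → ¬ F r ^ suc E ∣ n + l
    ∤ l l<6 with l ≟ s
    ... | yes refl = subst (λ x → ¬ F r ^ suc E ∣ x) (sym n+s≡) (p^[1+k]∤p^k* Fr-prime Fr∤o E)
    ... | no  l≢s  = maximal l l<6 l≢s ∘ ∣-trans (^-monoʳ-∣ (F r) (s≤s e≤E))
      where
      e≤E : e ≤ E
      e≤E = exponent-≤ Fr-prime Fr∤o e E (subst (F r ^ e ∣_) n+s≡ Fr^e∣)
  from : F r * lcm6 n ∣ k → PairCondition r n k
  from Fr*lcm6∣k i i+r<6 _ =
    ∣-trans (*-monoʳ-∣ (F r) (n+i∣lcm6 n i (≤-<-trans (m≤m+n i r) i+r<6))) Fr*lcm6∣k ,
    ∣-trans (*-monoʳ-∣ (F r) (n+i∣lcm6 n (i + r) i+r<6)) Fr*lcm6∣k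

multiplier-gcd5 : 1 ≤ n → Multiplier 5 n (gcd 5 n)
multiplier-gcd5 {n} 1≤n with 5 ∣? n
... | no 5∤n = subst (Multiplier 5 n) (sym (coprime⇒gcd≡1 (prime∤⇒coprime prime-5 5∤n))) (multiplier-1 no-pairs)
  where
  no-pairs : PairCondition 5 n (lcm6 n)
  no-pairs zero    _ 5∣n+0 = ⊥-elim (5∤n (subst (5 ∣_) (+-identityʳ n) 5∣n+0))
  no-pairs (suc i) i+5<6 _ = ⊥-elim (<⇒≱ i+5<6 (+-monoˡ-≤ 5 (s≤s z≤n)))
... | yes 5∣n = subst (Multiplier 5 n) (sym (∣-antisym (gcd[m,n]∣m 5 n) (gcd-greatest ∣-refl 5∣n))) multiplier
  where
  5∣n+0 : 5 ∣ n + 0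
  5∣n+0 = subst (5 ∣_) (sym (+-identityʳ n)) 5∣n
  5∣n+5 : 5 ∣ n + 5
  5∣n+5 = ∣m∣n⇒∣m+n 5∣n ∣-refl
  ¬25∣inner : ∀ l → 0 < l → l < 5 → ¬ 25 ∣ n + l
  ¬25∣inner l 0<l l<5 25∣n+l =
    <⇒≱ l<5 (∣⇒≤ {{>-nonZero 0<l}} (∣m+n∣m⇒∣n (∣-trans (divides 5 refl) 25∣n+l) 5∣n))
  multiplier : Multiplier 5 n 5
  multiplier with 25 ∣? n
  ... | yes 25∣n = multiplier-F[r] {e = 1} prime-5 1≤n (0 , ≤-refl , 5∣n+0 , inj₁ refl)
                     (subst (_∣ n + 0) (sym (*-identityʳ 5)) 5∣n+0) ∤
    where
    ∤ : ∀ l → l < 6 → l ≢ 0 → ¬ 25 ∣ n + l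
    ∤ l l<6 l≢0 with l ≟ 5
    ... | yes refl = λ 25∣n+5 → <⇒≱ (m≤m+n 6 19) (∣⇒≤ (∣m+n∣m⇒∣n 25∣n+5 25∣n))
    ... | no  l≢5  = ¬25∣inner l (n≢0⇒n>0 l≢0) (≤∧≢⇒< (≤-pred l<6) l≢5)
  ... | no 25∤n = multiplier-F[r] {e = 1} prime-5 1≤n (0 , ≤-refl , 5∣n+0 , inj₂ refl)
                     (subst (_∣ n + 5) (sym (*-identityʳ 5)) 5∣n+5) ∤
    where
    ∤ : ∀ l → l < 6 → l ≢ 5 → ¬ 25 ∣ n + l
    ∤ zero      _   _   = subst (λ x → ¬ 25 ∣ x) (sym (+-identityʳ n)) 25∤n
    ∤ l@(suc _) l<6 l≢5 = ¬25∣inner l (s≤s z≤n) (≤∧≢⇒< (≤-pred l<6) l≢5)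

admissible⇔ : ∀ {c₂ c₃ c₅} → 1 ≤ n → Multiplier 3 n c₂ → Multiplier 4 n c₃ → Multiplier 5 n c₅ →
              Coprime c₂ c₃ → Coprime (c₂ * c₃) c₅ → (Admissible n k ⇔ c₂ * c₃ * lcm6 n * c₅ ∣ k)
admissible⇔ {n} {k} {c₂} {c₃} {c₅} 1≤n M₂ M₃ M₅ c₂⊥c₃ c₂c₃⊥c₅ = mk⇔ to from
  where
  a : ℕ
  a = lcm6 n
  to : Admissible n k → c₂ * c₃ * a * c₅ ∣ k
  to adm = subst (_∣ k) (swap c₂ c₃ c₅ a)
    (coprime-*-∣ c₂c₃⊥c₅ (lcm6-pos 1≤n)
      (coprime-*-∣ c₂⊥c₃ (lcm6-pos 1≤n) (Equivalence.to (M₂ a∣k) pairs₂) (Equivalence.to (M₃ a∣k) pairs₃))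
      (Equivalence.to (M₅ a∣k) pairs₅))
    where
    open Admissible adm
    a∣k : a ∣ k
    a∣k = Equivalence.from lcm6-∣⇔ block
    swap : ∀ c₂ c₃ c₅ a → c₂ * c₃ * c₅ * a ≡ c₂ * c₃ * a * c₅
    swap = solve-∀
  from : c₂ * c₃ * a * c₅ ∣ k → Admissible n k
  from N∣k = record
    { block  = Equivalence.to lcm6-∣⇔ a∣k
    ; pairs₂ = Equivalence.from (M₂ a∣k) (∣-trans (divides (c₃ * c₅) (ring₂ c₂ c₃ c₅ a)) N∣k)
    ; pairs₃ = Equivalence.from (M₃ a∣k) (∣-trans (divides (c₂ * c₅) (ring₃ c₂ c₃ c₅ a)) N∣k)
    ; pairs₅ = Equivalence.from (M₅ a∣k) (∣-trans (divides (c₂ * c₃) (ring₅ c₂ c₃ c₅ a)) N∣k)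
    }
    where
    a∣k : a ∣ k
    a∣k = ∣-trans (divides (c₂ * c₃ * c₅) (ring c₂ c₃ c₅ a)) N∣k
      where
      ring : ∀ c₂ c₃ c₅ a → c₂ * c₃ * a * c₅ ≡ c₂ * c₃ * c₅ * a
      ring = solve-∀
    ring₂ : ∀ c₂ c₃ c₅ a → c₂ * c₃ * a * c₅ ≡ c₃ * c₅ * (c₂ * a)
    ring₂ = solve-∀
    ring₃ : ∀ c₂ c₃ c₅ a → c₂ * c₃ * a * c₅ ≡ c₂ * c₅ * (c₃ * a)
    ring₃ = solve-∀
    ring₅ : ∀ c₂ c₃ c₅ a → c₂ * c₃ * a * c₅ ≡ c₂ * c₃ * (c₅ * a)
    ring₅ = solve-∀

IsZ-of-⇔ : ∀ {N} → 0 < N → (∀ k → m ∣ F k ⇔ N ∣ k) → IsZ m N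
IsZ-of-⇔ {N = N} 0<N m∣F⇔ = 0<N , Equivalence.from (m∣F⇔ N) ∣-refl ,
  λ j 1≤j m∣F[j] → ∣⇒≤ {{>-nonZero 1≤j}} (Equivalence.to (m∣F⇔ j) m∣F[j])

prodF6≡∏F : ∀ n → prodF6 n ≡ ∏[ i < 6 ] F (n + i)
prodF6≡∏F n = trans (cong (λ x → F x * rest) (sym (+-identityʳ n)))
                    (ring (F (n + 0)) (F (n + 1)) (F (n + 2)) (F (n + 3)) (F (n + 4)) (F (n + 5)))
  where
  rest : ℕ
  rest = F (n + 1) * (F (n + 2) * (F (n + 3) * (F (n + 4) * F (n + 5))))
  ring : ∀ a b c d e f → a * (b * (c * (d * (e * f)))) ≡ 1 * a * b * c * d * e * f
  ring = solve-∀

z[prodF6] : ∀ {c₂ c₃} → 1 ≤ n → Multiplier 3 n c₂ → Multiplier 4 n c₃ → c₂ ∣ 2 → c₃ ∣ 3 →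
            IsZ (prodF6 n) (c₂ * c₃ * lcm6 n * gcd 5 n)
z[prodF6] {n} {c₂} {c₃} 1≤n M₂ M₃ c₂∣2 c₃∣3 = IsZ-of-⇔ 0<N λ k →
  admissible⇔ 1≤n M₂ M₃ (multiplier-gcd5 1≤n) c₂⊥c₃ c₂c₃⊥c₅
    ⇔-∘ (∣F⇔admissible 1≤n ⇔-∘ prodF6≡∏F-∣ k)
  where
  c₂⊥c₃ : Coprime c₂ c₃
  c₂⊥c₃ = coprime-∣ c₂∣2 c₃∣3 (from-yes (coprime? 2 3))
  c₂c₃⊥c₅ : Coprime (c₂ * c₃) (gcd 5 n)
  c₂c₃⊥c₅ = coprime-∣ (*-pres-∣ c₂∣2 c₃∣3) (gcd[m,n]∣m 5 n) (from-yes (coprime? 6 5))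
  prodF6≡∏F-∣ : ∀ k → prodF6 n ∣ F k ⇔ ∏[ i < 6 ] F (n + i) ∣ F k
  prodF6≡∏F-∣ k = mk⇔ (subst (_∣ F k) (prodF6≡∏F n)) (subst (_∣ F k) (sym (prodF6≡∏F n)))
  0<N : 0 < c₂ * c₃ * lcm6 n * gcd 5 n
  0<N = *-mono-< (*-mono-< (*-mono-< (∣suc⇒pos c₂∣2) (∣suc⇒pos c₃∣3)) (lcm6-pos 1≤n))
                 (∣suc⇒pos (gcd[m,n]∣m 5 n))

-- Residues modulo 72

-- Certificates for the two behaviours of the pair condition at p = F r (r = 3, 4), read off
-- the block m, …, m + 5.  They only involve divisors of 72, so they depend on m mod 72 alone
-- and can be decided by computation.
Dominated : ℕ → ℕ → ℕ → Set
Dominated r m s = ∃ λ l → l < 6 × ∃ λ k → k < 4 × (F r ^ k ∣ 72 × F r ^ k ∣ m + l × ¬ F r ^ k ∣ m + s)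

PairsDominated : ℕ → ℕ → Set
PairsDominated r m = ∀ {i} → i < 6 → i + r < 6 → r ∣ m + i → Dominated r m i × Dominated r m (i + r)

MaximalAt : ℕ → ℕ → ℕ → ℕ → Set
MaximalAt r e m s = F r ^ e ∣ m + s × (∀ {l} → l < 6 → l ≢ s → ¬ F r ^ suc e ∣ m + l)

HasMaximalMember : ℕ → ℕ → ℕ → Set
HasMaximalMember r e m = ∃ λ i → i < 6 × (i + r < 6 × r ∣ m + i × (MaximalAt r e m i ⊎ MaximalAt r e m (i + r)))

dominated? : ∀ r m s → Dec (Dominated r m s)
dominated? r m s =
  anyUpTo? (λ l → anyUpTo? (λ k → F r ^ k ∣? 72 ×-dec F r ^ k ∣? m + l ×-dec ¬? (F r ^ k ∣? m + s)) 4) 6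

pairsDominated? : ∀ r m → Dec (PairsDominated r m)
pairsDominated? r m =
  allUpTo? (λ i → (i + r <? 6) →-dec (r ∣? m + i) →-dec (dominated? r m i ×-dec dominated? r m (i + r))) 6

maximalAt? : ∀ r e m s → Dec (MaximalAt r e m s)
maximalAt? r e m s = F r ^ e ∣? m + s ×-dec allUpTo? (λ l → ¬? (l ≟ s) →-dec ¬? (F r ^ suc e ∣? m + l)) 6

hasMaximalMember? : ∀ r e m → Dec (HasMaximalMember r e m)
hasMaximalMember? r e m =
  anyUpTo? (λ i → i + r <? 6 ×-dec r ∣? m + i ×-dec (maximalAt? r e m i ⊎-dec maximalAt? r e m (i + r))) 6

%72-∣⇔ : d ∣ 72 → ∀ m l → (d ∣ m % 72 + l ⇔ d ∣ m + l)
%72-∣⇔ {d} d∣72 m l = mk⇔ (λ h → subst (d ∣_) (sym m+l≡) (∣m∣n⇒∣m+n h d∣Q))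
                           (λ h → ∣m+n∣m⇒∣n (subst (d ∣_) (trans m+l≡ (+-comm (m % 72 + l) Q)) h) d∣Q)
  where
  Q : ℕ
  Q = m / 72 * 72
  d∣Q : d ∣ Q
  d∣Q = ∣n⇒∣m*n (m / 72) d∣72
  m+l≡ : m + l ≡ m % 72 + l + Q
  m+l≡ = begin
    m + l                 ≡⟨ cong (_+ l) (m≡m%n+[m/n]*n m 72) ⟩
    m % 72 + Q + l        ≡⟨ +-assoc (m % 72) Q l ⟩
    m % 72 + (Q + l)      ≡⟨ cong (m % 72 +_) (+-comm Q l) ⟩
    m % 72 + (l + Q)      ≡⟨ +-assoc (m % 72) l Q ⟨
    m % 72 + l + Q        ∎
    where open ≡-Reasoning

pairsDominated-%72 : r ∣ 72 → PairsDominated r (m % 72) → PairsDominated r m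
pairsDominated-%72 {r} {m} r∣72 dominated i<6 i+r<6 r∣m+i =
  let dᵢ , dᵢ₊ᵣ = dominated i<6 i+r<6 (Equivalence.from (%72-∣⇔ r∣72 m _) r∣m+i) in lift dᵢ , lift dᵢ₊ᵣ
  where
  lift : Dominated r (m % 72) s → Dominated r m s
  lift {s} (l , l<6 , k , k<4 , Fr^k∣72 , Fr^k∣ , Fr^k∤) =
    l , l<6 , k , k<4 , Fr^k∣72 , Equivalence.to (%72-∣⇔ Fr^k∣72 m l) Fr^k∣ ,
    Fr^k∤ ∘ Equivalence.from (%72-∣⇔ Fr^k∣72 m s)

hasMaximalMember-%72 : r ∣ 72 → F r ^ suc e ∣ 72 → HasMaximalMember r e (m % 72) → HasMaximalMember r e m
hasMaximalMember-%72 {r} {e} {m} r∣72 Fr^[1+e]∣72 (i , i<6 , i+r<6 , r∣ , maximal) =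
  i , i<6 , i+r<6 , Equivalence.to (%72-∣⇔ r∣72 m i) r∣ , Sum.map lift lift maximal
  where
  Fr^e∣72 : F r ^ e ∣ 72
  Fr^e∣72 = ∣-trans (n∣m*n (F r)) Fr^[1+e]∣72
  lift : MaximalAt r e (m % 72) s → MaximalAt r e m s
  lift {s} (Fr^e∣ , Fr^[1+e]∤) = Equivalence.to (%72-∣⇔ Fr^e∣72 m s) Fr^e∣ ,
    λ l<6 l≢s → Fr^[1+e]∤ l<6 l≢s ∘ Equivalence.from (%72-∣⇔ Fr^[1+e]∣72 m _)

pairsDominated⇒PairCondition : Prime (F r) → PairsDominated r n → PairCondition r n (lcm6 n)
pairsDominated⇒PairCondition {r} {n} Fr-prime dominated i i+r<6 r∣n+i =
  let dᵢ , dᵢ₊ᵣ = dominated (≤-<-trans (m≤m+n i r) i+r<6) i+r<6 r∣n+i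
  in extend dᵢ (≤-<-trans (m≤m+n i r) i+r<6) , extend dᵢ₊ᵣ i+r<6
  where
  extend : Dominated r n s → s < 6 → F r * (n + s) ∣ lcm6 n
  extend {s} (l , l<6 , k , _ , _ , Fr^k∣ , Fr^k∤) s<6 =
    ∣-extend-by-prime {k = k} Fr-prime (n+i∣lcm6 n s s<6) (∣-trans Fr^k∣ (n+i∣lcm6 n l l<6)) Fr^k∤

hasMaximalMember⇒Multiplier : Prime (F r) → 1 ≤ n → HasMaximalMember r e n → Multiplier r n (F r)
hasMaximalMember⇒Multiplier {e = e} Fr-prime 1≤n (i , _ , i+r<6 , r∣n+i , inj₁ (Fr^e∣ , maximal)) =
  multiplier-F[r] {e = e} Fr-prime 1≤n (i , i+r<6 , r∣n+i , inj₁ refl) Fr^e∣ (λ l l<6 → maximal l<6)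
hasMaximalMember⇒Multiplier {e = e} Fr-prime 1≤n (i , _ , i+r<6 , r∣n+i , inj₂ (Fr^e∣ , maximal)) =
  multiplier-F[r] {e = e} Fr-prime 1≤n (i , i+r<6 , r∣n+i , inj₂ refl) Fr^e∣ (λ l l<6 → maximal l<6)


Class₁ Class₂ Class₃ Class₆ : ℕ → Set
Class₁ ρ = ρ % 12 ∈ 1 ∷ 2 ∷ 3 ∷ 4 ∷ 5 ∷ 6 ∷ [] ⊎ ρ ∈ 7 ∷ 8 ∷ 59 ∷ 60 ∷ []
Class₂ ρ = ρ % 12 ∈ 9 ∷ 10 ∷ [] ⊎ ρ ∈ 23 ∷ 24 ∷ 43 ∷ 44 ∷ []
Class₃ ρ = ρ ∈ 11 ∷ 12 ∷ 31 ∷ 32 ∷ 35 ∷ 36 ∷ 55 ∷ 56 ∷ []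
Class₆ ρ = ρ ∈ 0 ∷ 19 ∷ 20 ∷ 47 ∷ 48 ∷ 67 ∷ 68 ∷ 71 ∷ []

ResidueTable : ℕ → Set
ResidueTable ρ = (Class₁ ρ → PairsDominated 3 ρ × PairsDominated 4 ρ)
               × (Class₂ ρ → HasMaximalMember 3 2 ρ × PairsDominated 4 ρ)
               × (Class₃ ρ → PairsDominated 3 ρ × HasMaximalMember 4 1 ρ)
               × (Class₆ ρ → HasMaximalMember 3 2 ρ × HasMaximalMember 4 1 ρ)

residueTable? : ∀ ρ → Dec (ResidueTable ρ)
residueTable? ρ =
        ((ρ % 12 ∈? 1 ∷ 2 ∷ 3 ∷ 4 ∷ 5 ∷ 6 ∷ [] ⊎-dec ρ ∈? 7 ∷ 8 ∷ 59 ∷ 60 ∷ [])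
           →-dec (pairsDominated? 3 ρ ×-dec pairsDominated? 4 ρ))
  ×-dec ((ρ % 12 ∈? 9 ∷ 10 ∷ [] ⊎-dec ρ ∈? 23 ∷ 24 ∷ 43 ∷ 44 ∷ [])
           →-dec (hasMaximalMember? 3 2 ρ ×-dec pairsDominated? 4 ρ))
  ×-dec ((ρ ∈? 11 ∷ 12 ∷ 31 ∷ 32 ∷ 35 ∷ 36 ∷ 55 ∷ 56 ∷ [])
           →-dec (pairsDominated? 3 ρ ×-dec hasMaximalMember? 4 1 ρ))
  ×-dec ((ρ ∈? 0 ∷ 19 ∷ 20 ∷ 47 ∷ 48 ∷ 67 ∷ 68 ∷ 71 ∷ [])
           →-dec (hasMaximalMember? 3 2 ρ ×-dec hasMaximalMember? 4 1 ρ))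

-- Opaque, so that the exhaustive computation is not unfolded where the table is used.
opaque
  residue-table : ∀ {ρ} → ρ < 72 → ResidueTable ρ
  residue-table = from-yes (allUpTo? residueTable? 72)

theorem3p5 : ∀ (n : ℕ) → 1 ≤ n →
    let a = lcm6 n
        b = prodF6 n
        c = gcd 5 n
    in ((n % 12 ∈ 1 ∷ 2 ∷ 3 ∷ 4 ∷ 5 ∷ 6 ∷ [] ⊎ n % 72 ∈ 7 ∷ 8 ∷ 59 ∷ 60 ∷ []) → IsZ b (a * c))
     × ((n % 12 ∈ 9 ∷ 10 ∷ [] ⊎ n % 72 ∈ 23 ∷ 24 ∷ 43 ∷ 44 ∷ []) → IsZ b (2 * a * c))
     × (n % 72 ∈ 11 ∷ 12 ∷ 31 ∷ 32 ∷ 35 ∷ 36 ∷ 55 ∷ 56 ∷ [] → IsZ b (3 * a * c))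
     × (n % 72 ∈ 0 ∷ 19 ∷ 20 ∷ 47 ∷ 48 ∷ 67 ∷ 68 ∷ 71 ∷ [] → IsZ b (6 * a * c))
theorem3p5 n 1≤n with residue-table (m%n<n n 72)
... | table₁ , table₂ , table₃ , table₆ =
  (λ h → let d₂ , d₃ = table₁ (via-%72 h) in subst (λ x → IsZ (prodF6 n) (x * gcd 5 n)) (*-identityˡ (lcm6 n))
                                                (z[prodF6] 1≤n (dom₂ d₂) (dom₃ d₃) (1∣ 2) (1∣ 3))) ,
  (λ h → let m₂ , d₃ = table₂ (via-%72 h) in z[prodF6] 1≤n (max₂ m₂) (dom₃ d₃) ∣-refl (1∣ 3)) ,
  (λ h → let d₂ , m₃ = table₃ h in z[prodF6] 1≤n (dom₂ d₂) (max₃ m₃) (1∣ 2) ∣-refl) ,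
  (λ h → let m₂ , m₃ = table₆ h in z[prodF6] 1≤n (max₂ m₂) (max₃ m₃) ∣-refl ∣-refl)
  where
  via-%72 : ∀ {A B} → n % 12 ∈ A ⊎ n % 72 ∈ B → n % 72 % 12 ∈ A ⊎ n % 72 ∈ B
  via-%72 {A} = map₁ (subst (_∈ A) (sym (m∣n⇒o%n%m≡o%m 12 72 n (divides 6 refl))))
  dom₂ : PairsDominated 3 (n % 72) → Multiplier 3 n 1
  dom₂ = multiplier-1 ∘ pairsDominated⇒PairCondition prime[2] ∘ pairsDominated-%72 (divides 24 refl)
  dom₃ : PairsDominated 4 (n % 72) → Multiplier 4 n 1
  dom₃ = multiplier-1 ∘ pairsDominated⇒PairCondition prime-3 ∘ pairsDominated-%72 (divides 18 refl)
  max₂ : HasMaximalMember 3 2 (n % 72) → Multiplier 3 n 2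
  max₂ = hasMaximalMember⇒Multiplier {e = 2} prime[2] 1≤n
       ∘ hasMaximalMember-%72 {e = 2} (divides 24 refl) (divides 9 refl)
  max₃ : HasMaximalMember 4 1 (n % 72) → Multiplier 4 n 3
  max₃ = hasMaximalMember⇒Multiplier {e = 1} prime-3 1≤n
       ∘ hasMaximalMember-%72 {e = 1} (divides 18 refl) (divides 8 refl)
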